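{- Let $\ell,m\ge 2$ and let $H = (V,\mathcal{C},\mathcal{D})$ be an $(\ell,m)$-uniform mixed hypergraph with at least $\ell-1$ vertices. Then: (i) if $1 \in S(H)$, then $S(H)=[1, x]$ for some $x\geq \ell-1$; (ii) if $\ell = 2$, then $S(H)$ is an interval of integers; (iii) if $a \in S(H)$ for some $2 \leq a \leq \ell-1$, then $[a,\ell-1] \subseteq S(H)$.
   Context: A mixed hypergraph is a triple $H=(V,\mathcal{C},\mathcal{D})$ where $V$ is a finite set of vertices and $\mathcal{C}$, $\mathcal{D}$ are sets of subsets of $V$, called $C$-edges and $D$-edges. It is $(\ell,m)$-uniform if every $C$-edge has exactly $\ell$ elements and every $D$-edge has exactly $m$ elements. A coloring $c:V\to\mathbb{N}$ is proper if every $C$-edge contains two vertices of the same color and every $D$-edge contains two vertices of distinct colors. An $s$-coloring is a coloring using exactly $s$ colors. The feasible set $S(H)$ is the set of all $s$ such that $H$ has a proper $s$-coloring. For integers $i\le j$, $[i,j]=\{i,\ldots,j\}$. -}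

module Defs where

open import Data.Nat using (ℕ; _≤_; _∸_)
open import Data.Fin using (Fin)
open import Data.Fin.Subset using (Subset; _∈_; ∣_∣)
open import Data.List using (List)
open import Data.List.Relation.Unary.All using (All)
open import Data.Product using (Σ; _×_; ∃; ∃-syntax)
open import Relation.Binary.PropositionalEquality using (_≡_; _≢_)
open import Function.Definitions using (Surjective)

record MixedHypergraph (n : ℕ) : Set where
  field
    Cedges : List (Subset n)
    Dedges : List (Subset n)
open MixedHypergraph public

Uniform : ∀ {n} → ℕ → ℕ → MixedHypergraph n → Set
Uniform ℓ m H = All (λ E → ∣ E ∣ ≡ ℓ) (Cedges H) × All (λ E → ∣ E ∣ ≡ m) (Dedges H)

CGood : ∀ {n} {A : Set} → (Fin n → A) → Subset n → Set
CGood c E = ∃[ x ] ∃[ y ] (x ∈ E × y ∈ E × x ≢ y × c x ≡ c y)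

DGood : ∀ {n} {A : Set} → (Fin n → A) → Subset n → Set
DGood c E = ∃[ x ] ∃[ y ] (x ∈ E × y ∈ E × c x ≢ c y)

Proper : ∀ {n} {A : Set} → MixedHypergraph n → (Fin n → A) → Set
Proper H c = All (CGood c) (Cedges H) × All (DGood c) (Dedges H)

-- An s-coloring (using exactly s colors), up to renaming of colors:
-- a surjective map onto the color set Fin s.
Feasible : ∀ {n} → MixedHypergraph n → ℕ → Set
Feasible {n} H s = Σ (Fin n → Fin s) λ c → Surjective _≡_ _≡_ c × Proper H c

module Submission where

-- All three parts move between colourings with adjacent numbers of colours.
-- Splitting: recolouring a nonempty proper part of one colour class with a
-- fresh colour gives an onto colouring keeping every D-edge multicoloured.
-- For (iii) the part is a single vertex sharing its colour with another
-- (pigeonhole, as s < ℓ-1 ≤ n), and C-edges with ℓ > s+1 vertices stay good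
-- by pigeonhole.  For (ii) a b-colouring g with b > s separates some f-class,
-- the part is {z : f z = f x, g z = g x}, and a 2-vertex C-edge, being
-- monochromatic under f and g, stays monochromatic.
-- Merging: a 1-colouring exists only without D-edges; then colours may be
-- identified, so the feasible set is closed downwards, and its maximum x in
-- (i) is found by exhaustive (decidable) search.

open import Defs
open import Data.Nat using (ℕ; _≤_; _∸_)
open import Data.Product using (_×_; ∃-syntax)
open import Relation.Binary.PropositionalEquality using (_≡_)
open import Function.Bundles using (_⇔_)

open import Data.Bool using (Bool; true; false)
open import Data.Nat using (zero; suc; _<_; z≤n; s≤s; _≤′_; ≤′-refl; ≤′-step)
open import Data.Nat.Properties using (≤-refl; ≤-trans; <⇒≤; ≤-pred; ≤∧≢⇒<; <-≤-trans; ≤⇒≤′; ≤′⇒≤; <⇒≱)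
open import Data.Fin using (Fin; zero; suc; pinch; _≟_)
open import Data.Fin.Properties using (any?; all?; pigeonhole; injective⇒≤; suc-injective; <⇒≢; pinch-surjective)
open import Data.Fin.Subset using (Subset; _∈_; ∣_∣; inside; outside; _-_)
open import Data.Fin.Subset.Properties using (_∈?_; x∈p∧x≢y⇒x∈p-y; x∈p⇒∣p-x∣<∣p∣)
open import Data.Vec using (_∷_; here; there)
open import Data.Vec.Functional as Vector using ()
open import Data.List using ([]; _∷_)
open import Data.List.Relation.Unary.All as All using (All; []; _∷_)
open import Data.Product using (∃; _,_; proj₁; proj₂)
open import Data.Empty using (⊥; ⊥-elim)
open import Function using (_∘_)
open import Function.Bundles using (mk⇔)
open import Function.Definitions using (StrictlySurjective; Injective)
open import Function.Consequences.Propositional using (strictlySurjective⇒surjective; surjective⇒strictlySurjective)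
import Function.Construct.Composition as Composition
open import Relation.Nullary using (Dec; yes; no; ¬_; ¬?; _×-dec_; contradiction; does)
open import Relation.Nullary.Decidable using (dec-true; dec-false; decidable-stable; map′)
open import Relation.Unary using (Decidable)
open import Relation.Binary.PropositionalEquality using (refl; sym; trans; cong; cong₂; subst; _≢_)

climb : (P : ℕ → Set) {a b : ℕ} → (∀ s → s < b → P s → P (suc s)) → P a →
        ∀ s → a ≤ s → s ≤ b → P s
climb P {a} {b} step pa s a≤s = go (≤⇒≤′ a≤s)
  where
  go : ∀ {t} → a ≤′ t → t ≤ b → P t
  go ≤′-refl _ = pa
  go (≤′-step {t} a≤′t) t<b = step t t<b (go a≤′t (<⇒≤ t<b))

descend : (P : ℕ → Set) → (∀ t → P (suc (suc t)) → P (suc t)) →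
          ∀ {x} → P x → ∀ s → 1 ≤ s → s ≤ x → P s
descend P step px s 1≤s s≤x = go (≤⇒≤′ s≤x) px
  where
  go : ∀ {y} → s ≤′ y → P y → P s
  go ≤′-refl py = py
  go (≤′-step {suc t} s≤′t) py = go s≤′t (step t py)
  go (≤′-step {zero} s≤′0) _ = contradiction (≤-trans 1≤s (≤′⇒≤ s≤′0)) λ ()

greatest : (P : ℕ → Set) → Decidable P → ∀ N → (∃ λ w → w ≤ N × P w) →
           ∃ λ x → P x × (∀ s → s ≤ N → P s → s ≤ x)
greatest P P? zero (w , z≤n , pw) = zero , pw , λ { _ z≤n _ → z≤n }
greatest P P? (suc N) (w , w≤ , pw) with P? (suc N)
... | yes pN = suc N , pN , λ _ s≤ _ → s≤
... | no ¬pN =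
  let x , px , max = greatest P P? N (w , below-top w≤ pw , pw)
  in x , px , λ s s≤ ps → max s (below-top s≤ ps) ps
  where
  below-top : ∀ {s} → s ≤ suc N → P s → s ≤ N
  below-top s≤ ps = ≤-pred (≤∧≢⇒< s≤ λ { refl → ¬pN ps })

-- A surjection Fin a → Fin b forces b ≤ a, since any section is injective.
surjection⇒≤ : ∀ {a b} {f : Fin a → Fin b} → StrictlySurjective _≡_ f → b ≤ a
surjection⇒≤ {f = f} onto = injective⇒≤ section-injective
  where
  section-injective : Injective _≡_ _≡_ (proj₁ ∘ onto)
  section-injective {y} {y′} eq = trans (sym (proj₂ (onto y))) (trans (cong f eq) (proj₂ (onto y′)))

-- If the onto map g is constant on the fibres of the onto map f, then g
-- factors through f, so g has at most as many colours as f.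
factor⇒≤ : ∀ {n s b} {f : Fin n → Fin s} {g : Fin n → Fin b} →
           StrictlySurjective _≡_ f → StrictlySurjective _≡_ g →
           (∀ x y → f x ≡ f y → g x ≡ g y) → b ≤ s
factor⇒≤ {s = s} {b} {f} {g} f-onto g-onto g-factors = surjection⇒≤ induced-onto
  where
  induced : Fin s → Fin b
  induced c = g (proj₁ (f-onto c))
  induced-onto : StrictlySurjective _≡_ induced
  induced-onto d with g-onto d
  ... | z , refl = f z , g-factors _ z (proj₂ (f-onto (f z)))

enum : ∀ {n} (E : Subset n) → Fin ∣ E ∣ → Fin n
enum (inside ∷ E) zero = zero
enum (inside ∷ E) (suc i) = suc (enum E i)
enum (outside ∷ E) i = suc (enum E i)

enum-∈ : ∀ {n} (E : Subset n) i → enum E i ∈ E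
enum-∈ (inside ∷ E) zero = here
enum-∈ (inside ∷ E) (suc i) = there (enum-∈ E i)
enum-∈ (outside ∷ E) i = there (enum-∈ E i)

enum-injective : ∀ {n} (E : Subset n) → Injective _≡_ _≡_ (enum E)
enum-injective (inside ∷ E) {zero} {zero} _ = refl
enum-injective (inside ∷ E) {suc i} {suc j} eq = cong suc (enum-injective E (suc-injective eq))
enum-injective (outside ∷ E) eq = enum-injective E (suc-injective eq)

pigeonhole-edge : ∀ {n k} (E : Subset n) (c : Fin n → Fin k) → k < ∣ E ∣ → CGood c E
pigeonhole-edge E c k<∣E∣ with pigeonhole k<∣E∣ (c ∘ enum E)
... | i , j , i<j , same = enum E i , enum E j , enum-∈ E i , enum-∈ E j ,
      (λ eq → <⇒≢ i<j (enum-injective E eq)) , same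

three⇒3≤∣E∣ : ∀ {n} {E : Subset n} {u v w} → u ∈ E → v ∈ E → w ∈ E →
              v ≢ u → w ≢ u → w ≢ v → 3 ≤ ∣ E ∣
three⇒3≤∣E∣ {E = E} {u} {v} {w} u∈ v∈ w∈ v≢u w≢u w≢v =
  grow (grow (grow z≤n (x∈p⇒∣p-x∣<∣p∣ w∈E-u-v)) (x∈p⇒∣p-x∣<∣p∣ v∈E-u)) (x∈p⇒∣p-x∣<∣p∣ u∈)
  where
  -- removing a member lowers the size, so each removal adds one to the bound
  grow : ∀ {k a b} → k ≤ a → a < b → suc k ≤ b
  grow k≤a a<b = ≤-trans (s≤s k≤a) a<b
  v∈E-u : v ∈ E - u
  v∈E-u = x∈p∧x≢y⇒x∈p-y v∈ v≢u
  w∈E-u-v : w ∈ E - u - v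
  w∈E-u-v = x∈p∧x≢y⇒x∈p-y (x∈p∧x≢y⇒x∈p-y w∈ w≢u) w≢v

no-third-member : ∀ {n} {E : Subset n} {u v w} → ∣ E ∣ ≡ 2 → u ∈ E → v ∈ E → w ∈ E →
                  v ≢ u → w ≢ u → w ≢ v → ⊥
no-third-member size u∈ v∈ w∈ v≢u w≢u w≢v with subst (3 ≤_) size (three⇒3≤∣E∣ u∈ v∈ w∈ v≢u w≢u w≢v)
... | s≤s (s≤s ())

-- In a properly coloured C-edge with exactly two vertices, the two
-- vertices have the same colour: any distinct pair in it is the good pair.
two-edge-monochromatic : ∀ {n} {A : Set} {E : Subset n} (c : Fin n → A) →
                         ∣ E ∣ ≡ 2 → CGood c E → ∀ {a b} → a ∈ E → b ∈ E → a ≢ b → c a ≡ c b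
two-edge-monochromatic c size (u , v , u∈ , v∈ , u≢v , cu≡cv) {a} {b} a∈ b∈ a≢b
  with a ≟ u | a ≟ v | b ≟ u | b ≟ v
... | no a≢u | no a≢v | _ | _ = ⊥-elim (no-third-member size u∈ v∈ a∈ (u≢v ∘ sym) a≢u a≢v)
... | _ | _ | no b≢u | no b≢v = ⊥-elim (no-third-member size u∈ v∈ b∈ (u≢v ∘ sym) b≢u b≢v)
... | yes refl | _ | _ | yes refl = cu≡cv
... | _ | yes refl | yes refl | _ = sym cu≡cv
... | yes refl | _ | yes refl | _ = contradiction refl a≢b
... | _ | yes refl | _ | yes refl = contradiction refl a≢b

CGood-map : ∀ {n} {A B : Set} (φ : A → B) {c : Fin n → A} {E} → CGood c E → CGood (φ ∘ c) E
CGood-map φ (x , y , x∈ , y∈ , x≢y , same) = x , y , x∈ , y∈ , x≢y , cong φ same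

module Split {n s} (f : Fin n → Fin s) {M : Fin n → Set} (M? : Decidable M)
             {x y : Fin n} (x∈M : M x) (y∉M : ¬ M y) (fy≡fx : f y ≡ f x)
             (M-in-class : ∀ {z} → M z → f z ≡ f x) where

  recolour : Bool → Fin s → Fin (suc s)
  recolour true _ = zero
  recolour false c = suc c

  split : Fin n → Fin (suc s)
  split z = recolour (does (M? z)) (f z)

  split-marked : ∀ {z} → M z → split z ≡ zero
  split-marked {z} mz = cong (λ b → recolour b (f z)) (dec-true (M? z) mz)

  split-unmarked : ∀ {z} → ¬ M z → split z ≡ suc (f z)
  split-unmarked {z} ¬mz = cong (λ b → recolour b (f z)) (dec-false (M? z) ¬mz)

  -- zero is hit by x, and an old colour c by a vertex of colour c outside M,
  -- which is y if every vertex of colour c lies in M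
  split-onto : StrictlySurjective _≡_ f → StrictlySurjective _≡_ split
  split-onto f-onto zero = x , split-marked x∈M
  split-onto f-onto (suc c) with f-onto c
  ... | z , refl with M? z
  ... | no ¬mz = z , split-unmarked ¬mz
  ... | yes mz = y , trans (split-unmarked y∉M) (cong suc (trans fy≡fx (sym (M-in-class mz))))

  -- splitting refines f, so multicoloured D-edges stay multicoloured
  split-DGood : ∀ {E} → DGood f E → DGood split E
  split-DGood (a , b , a∈ , b∈ , fa≢fb) = a , b , a∈ , b∈ , distinct (M? a) (M? b)
    where
    distinct : (ma : Dec (M a)) (mb : Dec (M b)) → recolour (does ma) (f a) ≢ recolour (does mb) (f b)
    distinct (yes ma) (yes mb) _ = fa≢fb (trans (M-in-class ma) (sym (M-in-class mb)))
    distinct (yes _) (no _) ()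
    distinct (no _) (yes _) ()
    distinct (no _) (no _) eq = fa≢fb (suc-injective eq)

Extensional : ∀ {n s} → ((Fin n → Fin s) → Set) → Set
Extensional P = ∀ {f g} → (∀ i → f i ≡ g i) → P f → P g

search : ∀ n {s} {P : (Fin n → Fin s) → Set} → Extensional P → Decidable P → Dec (∃ P)
search zero P-ext P? with P? (λ ())
... | yes p = yes (_ , p)
... | no ¬p = no λ (f , pf) → ¬p (P-ext (λ ()) pf)
search (suc n) {P = P} P-ext P? with any? (λ a → search n (fixing a) (λ v → P? (a Vector.∷ v)))
  where
  fixing : ∀ a → Extensional (λ v → P (a Vector.∷ v))
  fixing a eq = P-ext λ { zero → refl ; (suc i) → eq i }
... | yes (a , v , p) = yes (a Vector.∷ v , p)
... | no ¬p = no λ (f , pf) → ¬p (f zero , f ∘ suc , P-ext (λ { zero → refl ; (suc i) → refl }) pf)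

CGood-extensional : ∀ {n s} (E : Subset n) → Extensional {n} {s} (λ c → CGood c E)
CGood-extensional E eq (x , y , x∈ , y∈ , x≢y , same) = x , y , x∈ , y∈ , x≢y , trans (sym (eq x)) (trans same (eq y))

DGood-extensional : ∀ {n s} (E : Subset n) → Extensional {n} {s} (λ c → DGood c E)
DGood-extensional E eq (x , y , x∈ , y∈ , differ) = x , y , x∈ , y∈ , λ same → differ (trans (eq x) (trans same (sym (eq y))))

onto-extensional : ∀ {n s} → Extensional {n} {s} (StrictlySurjective _≡_)
onto-extensional eq onto c = proj₁ (onto c) , trans (sym (eq _)) (proj₂ (onto c))

CGood? : ∀ {n s} (c : Fin n → Fin s) → Decidable (CGood c)
CGood? c E = any? λ x → any? λ y → (x ∈? E) ×-dec (y ∈? E) ×-dec ¬? (x ≟ y) ×-dec (c x ≟ c y)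

DGood? : ∀ {n s} (c : Fin n → Fin s) → Decidable (DGood c)
DGood? c E = any? λ x → any? λ y → (x ∈? E) ×-dec (y ∈? E) ×-dec ¬? (c x ≟ c y)

onto? : ∀ {n s} → Decidable {A = Fin n → Fin s} (StrictlySurjective _≡_)
onto? c = all? λ y → any? λ x → c x ≟ y

module _ {n : ℕ} (H : MixedHypergraph n) where

  feasible : ∀ {s} (c : Fin n → Fin s) → StrictlySurjective _≡_ c → Proper H c → Feasible H s
  feasible c onto proper = c , strictlySurjective⇒surjective onto , proper

  feasible⇒≤ : ∀ {s} → Feasible H s → s ≤ n
  feasible⇒≤ (c , onto , _) = surjection⇒≤ (surjective⇒strictlySurjective onto)

  feasible⇒positive : ∀ {s} → Fin n → Feasible H s → 1 ≤ s
  feasible⇒positive v (c , _) with c v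
  ... | zero = s≤s z≤n
  ... | suc _ = s≤s z≤n

  step-large-edges : ∀ {s} → All (λ E → suc s < ∣ E ∣) (Cedges H) → s < n →
                     Feasible H s → Feasible H (suc s)
  step-large-edges large s<n (f , f-onto , _ , D-good)
    with pigeonhole s<n f
  ... | i , j , i<j , fi≡fj =
    feasible split (split-onto (surjective⇒strictlySurjective f-onto))
      (All.map (λ {E} size → pigeonhole-edge E split size) large , All.map split-DGood D-good)
    where
    open Split f (_≟ i) refl (λ j≡i → <⇒≢ i<j (sym j≡i)) (sym fi≡fj) (cong f)

  step-two-edges : All (λ E → ∣ E ∣ ≡ 2) (Cedges H) → ∀ {s b} → s < b →
                   Feasible H s → Feasible H b → Feasible H (suc s)
  step-two-edges pairs s<b (f , f-onto , C-good-f , D-good-f) (g , g-onto , C-good-g , _)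
    with any? (λ x → any? (λ y → (f y ≟ f x) ×-dec ¬? (g y ≟ g x)))
  ... | yes (x , y , fy≡fx , gy≢gx) =
    feasible split (split-onto (surjective⇒strictlySurjective f-onto))
      (C-good (Cedges H) pairs C-good-f C-good-g , All.map split-DGood D-good-f)
    where
    open Split f (λ z → (f z ≟ f x) ×-dec (g z ≟ g x)) (refl , refl) (gy≢gx ∘ proj₂) fy≡fx proj₁
    -- split depends only on the pair of colours (f z, g z), and a good
    -- 2-edge is monochromatic for both f and g
    C-good : ∀ Es → All (λ E → ∣ E ∣ ≡ 2) Es → All (CGood f) Es → All (CGood g) Es → All (CGood split) Es
    C-good [] [] [] [] = []
    C-good (E ∷ Es) (size ∷ sizes) (good-f ∷ goods-f) ((a , a′ , a∈ , a′∈ , a≢a′ , ga≡ga′) ∷ goods-g) =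
      (a , a′ , a∈ , a′∈ , a≢a′ ,
        cong₂ (λ c d → recolour (does ((c ≟ f x) ×-dec (d ≟ g x))) c)
          (two-edge-monochromatic f size good-f a∈ a′∈ a≢a′) ga≡ga′)
      ∷ C-good Es sizes goods-f goods-g
  ... | no no-split = contradiction
    (factor⇒≤ (surjective⇒strictlySurjective f-onto) (surjective⇒strictlySurjective g-onto) g-factors)
    (<⇒≱ s<b)
    where
    -- no vertex pair separates an f-class under g, so g is constant on f-classes
    g-factors : ∀ x y → f x ≡ f y → g x ≡ g y
    g-factors x y fx≡fy = sym (decidable-stable (g y ≟ g x) λ gy≢gx → no-split (x , y , sym fx≡fy , gy≢gx))

  one-colour⇒no-D-edges : Feasible H 1 → Dedges H ≡ []
  one-colour⇒no-D-edges (c , _ , _ , D-good) with Dedges H | D-good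
  ... | [] | [] = refl
  ... | _ ∷ _ | (x , y , _ , _ , cx≢cy) ∷ _ with c x | c y
  ...   | zero | zero = contradiction refl cx≢cy

  step-down : Dedges H ≡ [] → ∀ t → Feasible H (suc (suc t)) → Feasible H (suc t)
  step-down no-D t (f , f-onto , C-good , _) =
    pinch zero ∘ f ,
    Composition.surjective _≡_ _≡_ _≡_ f-onto (pinch-surjective zero) ,
    All.map (CGood-map (pinch zero)) C-good ,
    subst (All _) (sym no-D) []

  feasible? : Decidable (Feasible H)
  feasible? s = map′ (λ (c , onto , proper) → feasible c onto proper)
                     (λ (c , onto , proper) → c , surjective⇒strictlySurjective onto , proper)
                     (search n extensional decide)
    where
    extensional : Extensional (λ c → StrictlySurjective _≡_ c × Proper H c)
    extensional eq (onto , C-good , D-good) =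
      onto-extensional eq onto ,
      All.map (λ {E} → CGood-extensional E eq) C-good , All.map (λ {E} → DGood-extensional E eq) D-good
    decide : Decidable (λ (c : Fin n → Fin s) → StrictlySurjective _≡_ c × Proper H c)
    decide c = onto? c ×-dec All.all? (CGood? c) (Cedges H) ×-dec All.all? (DGood? c) (Dedges H)

lemma3 : ∀ (ℓ m n : ℕ) (H : MixedHypergraph n) →
    2 ≤ ℓ → 2 ≤ m → Uniform ℓ m H → ℓ ∸ 1 ≤ n →
    (Feasible H 1 →
      ∃[ x ] (ℓ ∸ 1 ≤ x × (∀ s → Feasible H s ⇔ (1 ≤ s × s ≤ x))))
    × (ℓ ≡ 2 →
      ∀ a b s → a ≤ s → s ≤ b → Feasible H a → Feasible H b → Feasible H s)
    × (∀ a → 2 ≤ a → a ≤ ℓ ∸ 1 → Feasible H a →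
      ∀ s → a ≤ s → s ≤ ℓ ∸ 1 → Feasible H s)
lemma3 (suc ℓ′) _ n H (s≤s 1≤ℓ′) _ (C-uniform , _) ℓ′≤n = part-i , part-ii , part-iii
  where
  -- below ℓ-1 colours every C-edge has room for one more colour
  climb-to-ℓ-1 : ∀ a → Feasible H a → ∀ s → a ≤ s → s ≤ ℓ′ → Feasible H s
  climb-to-ℓ-1 a = climb (Feasible H) λ t t<ℓ′ →
    step-large-edges H (All.map (λ size → subst (suc t <_) (sym size) (s≤s t<ℓ′)) C-uniform) (<-≤-trans t<ℓ′ ℓ′≤n)

  part-i : Feasible H 1 → ∃[ x ] (ℓ′ ≤ x × (∀ s → Feasible H s ⇔ (1 ≤ s × s ≤ x)))
  part-i f1 with greatest (Feasible H) (feasible? H) n (1 , feasible⇒≤ H f1 , f1)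
  ... | x , fx , maximal =
    x , maximal ℓ′ ℓ′≤n (climb-to-ℓ-1 1 f1 ℓ′ 1≤ℓ′ ≤-refl) , λ s → mk⇔
      (λ fs → feasible⇒positive H vertex fs , maximal s (feasible⇒≤ H fs) fs)
      (λ (1≤s , s≤x) → descend (Feasible H) (step-down H (one-colour⇒no-D-edges H f1)) fx s 1≤s s≤x)
    where
    vertex : Fin n
    vertex = proj₁ (surjective⇒strictlySurjective (proj₁ (proj₂ f1)) zero)

  part-ii : suc ℓ′ ≡ 2 → ∀ a b s → a ≤ s → s ≤ b → Feasible H a → Feasible H b → Feasible H s
  part-ii ℓ≡2 a b s a≤s s≤b fa fb = climb (Feasible H) (λ t t<b ft → step-two-edges H pairs t<b ft fb) fa s a≤s s≤b
    where
    pairs : All (λ E → ∣ E ∣ ≡ 2) (Cedges H)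
    pairs = subst (λ k → All (λ E → ∣ E ∣ ≡ k) (Cedges H)) ℓ≡2 C-uniform

  part-iii : ∀ a → 2 ≤ a → a ≤ ℓ′ → Feasible H a → ∀ s → a ≤ s → s ≤ ℓ′ → Feasible H s
  part-iii a _ _ = climb-to-ℓ-1 a
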